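{- Let $G$ be a connected cograph that is $k$-connected, and let $S\subset V(G)$ be a minimal vertex separator of $G$ with $|S|=k$. Then every vertex $x\in S$ is adjacent to every vertex of $V(G)\setminus S$.
   Context: All graphs are finite, simple and undirected. A cograph is a graph containing no induced path on four vertices ($P_4$-free). A vertex separator of a connected graph $G$ is a set $S\subset V(G)$ such that $G\setminus S$ is disconnected; it is minimal if no proper subset of it is a vertex separator. A graph is called $k$-connected if the minimum cardinality of a vertex separator of $G$ equals $k$. -}

module Defs where

open import Data.Nat using (ℕ; _≤_; _≥_; suc)
open import Data.Bool using (Bool; true; false)
open import Data.Fin using (Fin)
open import Data.Fin.Subset using (Subset; _∈_; _∉_; _⊂_; ∁; ∣_∣; ⊤)
open import Data.Product using (Σ; ∃; _×_; _,_)
open import Relation.Binary.PropositionalEquality using (_≡_; _≢_)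
open import Relation.Nullary using (¬_)

record Graph (n : ℕ) : Set where
  field
    adj   : Fin n → Fin n → Bool
    sym   : ∀ x y → adj x y ≡ adj y x
    irrefl : ∀ x → adj x x ≡ false

open Graph public

module _ {n : ℕ} (G : Graph n) where

  Adj : Fin n → Fin n → Set
  Adj x y = adj G x y ≡ true

  data ReachIn (U : Subset n) (x : Fin n) : Fin n → Set where
    here : x ∈ U → ReachIn U x x
    step : ∀ {y z} → ReachIn U x y → Adj y z → z ∈ U → ReachIn U x z

  Connected : Set
  Connected = Fin n × (∀ x y → ReachIn ⊤ x y)

  IsSeparator : Subset n → Set
  IsSeparator S = Σ (Fin n) λ x → Σ (Fin n) λ y →
    x ∉ S × y ∉ S × ¬ ReachIn (∁ S) x y

  IsMinimalSeparator : Subset n → Set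
  IsMinimalSeparator S = IsSeparator S × (∀ T → T ⊂ S → ¬ IsSeparator T)

  KConnected : ℕ → Set
  KConnected k = (Σ (Subset n) λ S → IsSeparator S × ∣ S ∣ ≡ k)
               × (∀ S → IsSeparator S → k ≤ ∣ S ∣)

  InducedP4 : Fin n → Fin n → Fin n → Fin n → Set
  InducedP4 a b c d =
    a ≢ b × a ≢ c × a ≢ d × b ≢ c × b ≢ d × c ≢ d ×
    Adj a b × Adj b c × Adj c d ×
    adj G a c ≡ false × adj G b d ≡ false × adj G a d ≡ false

  Cograph : Set
  Cograph = ∀ a b c d → ¬ InducedP4 a b c d

-- Let x ∈ S with x ≁ y.  By minimality S - x is no separator, so in G - (S - x) every
-- component C of G - S is joined to x; hence x has a neighbour in every such C.  In a
-- cograph a vertex outside U with neighbours in two different components of G[U] is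
-- adjacent to the whole of both (otherwise an induced P4 d – x – c – c' appears).  Since
-- S separates, G - S has a second component besides that of y, so x ~ y after all.
-- Connectivity and the value of k play no role.
module Submission where

open import Defs
open import Data.Nat using (ℕ)
open import Data.Fin using (Fin; suc; _≟_)
open import Data.Fin.Subset using (Subset; _∈_; _∉_; ∣_∣; ∁; _-_)
open import Data.Fin.Subset.Properties
  using (x∈∁p⇒x∉p; x∉p⇒x∈∁p; x∈p⇒x∉∁p; x∈p⇒p-x⊂p; x∈p∧x≢y⇒x∈p-y; p─q⊆p)
open import Data.Vec using (_∷_; there)
open import Data.Bool using (true; false)
open import Data.Product using (Σ; _×_; _,_)
open import Data.Sum using (_⊎_; inj₁; inj₂)
open import Data.Empty using (⊥; ⊥-elim)
open import Function using (_∘_; case_of_)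
open import Relation.Nullary using (¬_; yes; no)
open import Relation.Binary.PropositionalEquality
  using (_≡_; _≢_; refl; trans; subst)
  renaming (sym to ≡-sym)

x∉p-x : ∀ {n} (p : Subset n) (x : Fin n) → x ∉ p - x
x∉p-x (_ ∷ p) (suc x) (there x∈p-x) = x∉p-x p x x∈p-x

x∈∁[p-y]∧x≢y⇒x∈∁p : ∀ {n} {p : Subset n} {x y} → x ∈ ∁ (p - y) → x ≢ y → x ∈ ∁ p
x∈∁[p-y]∧x≢y⇒x∈∁p x∈∁[p-y] x≢y =
  x∉p⇒x∈∁p (λ x∈p → x∈∁p⇒x∉p x∈∁[p-y] (x∈p∧x≢y⇒x∈p-y x∈p x≢y))

module _ {n : ℕ} (G : Graph n) where

  Adj-sym : ∀ {x y} → Adj G x y → Adj G y x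
  Adj-sym {x} {y} x~y = trans (Graph.sym G y x) x~y

  Adj⇒≢ : ∀ {x y} → Adj G x y → x ≢ y
  Adj⇒≢ {x} x~x refl with trans (≡-sym x~x) (Graph.irrefl G x)
  ... | ()

  module _ {U : Subset n} where

    ReachIn-target∈ : ∀ {x y} → ReachIn G U x y → y ∈ U
    ReachIn-target∈ (here y∈U)     = y∈U
    ReachIn-target∈ (step _ _ y∈U) = y∈U

    ReachIn-trans : ∀ {x y z} → ReachIn G U x y → ReachIn G U y z → ReachIn G U x z
    ReachIn-trans p (here _)         = p
    ReachIn-trans p (step q y~z z∈U) = step (ReachIn-trans p q) y~z z∈U

    ReachIn-sym : ∀ {x y} → ReachIn G U x y → ReachIn G U y x
    ReachIn-sym (here x∈U) = here x∈U
    ReachIn-sym (step p w~y y∈U) =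
      ReachIn-trans (step (here y∈U) (Adj-sym w~y) (ReachIn-target∈ p)) (ReachIn-sym p)

    Touches : Fin n → Fin n → Set
    Touches x y = Σ (Fin n) λ c → ReachIn G U y c × Adj G x c

    -- Follow a path through U ∪ {x} until it first steps onto x.
    reach-or-touch : ∀ {V : Subset n} {x y z} → (∀ {w} → w ∈ V → w ≢ x → w ∈ U) →
      y ∈ U → ReachIn G V y z → ReachIn G U y z ⊎ Touches x y
    reach-or-touch _ y∈U (here _) = inj₁ (here y∈U)
    reach-or-touch {x = x} V⊆U∪x y∈U (step {w} {z} p w~z z∈V)
      with reach-or-touch V⊆U∪x y∈U p
    ... | inj₂ t = inj₂ t
    ... | inj₁ y⇝w with z ≟ x
    ...   | yes refl = inj₂ (w , y⇝w , Adj-sym w~z)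
    ...   | no z≢x   = inj₁ (step y⇝w w~z (V⊆U∪x z∈V z≢x))

    adjacent-to-component : Cograph G → ∀ {x c d z} → x ∉ U →
      Adj G x d → d ∈ U → ¬ ReachIn G U c d →
      Adj G x c → ReachIn G U c z → Adj G x z
    adjacent-to-component _ _ _ _ _ x~c (here _) = x~c
    adjacent-to-component cog {x} {c} {d} {z} x∉U x~d d∈U c↛d x~c (step {w} c⇝w w~z z∈U)
      with adj G x z in x≁z
    ... | true  = refl
    ... | false = ⊥-elim (cog d x w z
      ( (λ d≡x → x∉U (subst (_∈ U) d≡x d∈U))
      , (λ d≡w → c↛d (subst (ReachIn G U c) (≡-sym d≡w) c⇝w))
      , (λ d≡z → c↛d (subst (ReachIn G U c) (≡-sym d≡z) c⇝z))
      , (λ x≡w → x∉U (subst (_∈ U) (≡-sym x≡w) (ReachIn-target∈ c⇝w)))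
      , (λ x≡z → x∉U (subst (_∈ U) (≡-sym x≡z) z∈U))
      , Adj⇒≢ w~z
      , Adj-sym x~d
      , adjacent-to-component cog x∉U x~d d∈U c↛d x~c c⇝w
      , w~z
      , d≁ c⇝w , x≁z , d≁ c⇝z ))
      where
      c⇝z : ReachIn G U c z
      c⇝z = step c⇝w w~z z∈U

      d≁ : ∀ {v} → ReachIn G U c v → adj G d v ≡ false
      d≁ {v} c⇝v with adj G d v in d~v
      ... | false = refl
      ... | true  = ⊥-elim (c↛d (step c⇝v (Adj-sym d~v) d∈U))

  touches-every-component : ∀ {S : Subset n} {x y} → ¬ IsSeparator G (S - x) →
    x ∈ S → y ∉ S → ¬ ¬ Touches {∁ S} x y
  touches-every-component {S} {x} {y} S-x-connects x∈S y∉S ¬touch =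
    S-x-connects (y , x , y∉S ∘ p─q⊆p S _ , x∉p-x S x , λ y⇝x →
      case-split (reach-or-touch x∈∁[p-y]∧x≢y⇒x∈∁p (x∉p⇒x∈∁p y∉S) y⇝x))
    where
    case-split : ReachIn G (∁ S) y x ⊎ Touches {∁ S} x y → ⊥
    case-split (inj₁ y⇝x) = x∈∁p⇒x∉p (ReachIn-target∈ y⇝x) x∈S
    case-split (inj₂ t)   = ¬touch t

lemma2 : ∀ {n : ℕ} (G : Graph n) (k : ℕ) (S : Subset n) →
    Connected G → Cograph G → KConnected G k →
    IsMinimalSeparator G S → ∣ S ∣ ≡ k →
    ∀ x y → x ∈ S → y ∉ S → Adj G x y
lemma2 G k S _ cog _ ((a , b , a∉S , b∉S , a↛b) , minimal) _ x y x∈S y∉S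
  with adj G x y in x≁y
... | true  = refl
... | false = ⊥-elim (escape a∉S λ y⇝a → escape b∉S λ y⇝b →
                a↛b (ReachIn-trans G (ReachIn-sym G y⇝a) y⇝b))
  where
  touches : ∀ {w} → w ∉ S → ¬ ¬ Touches G {∁ S} x w
  touches = touches-every-component G (minimal (S - x) (x∈p⇒p-x⊂p x∈S)) x∈S

  escape : ∀ {w} → w ∉ S → ¬ ¬ ReachIn G (∁ S) y w
  escape w∉S y↛w = touches y∉S λ { (c , y⇝c , x~c) → touches w∉S λ { (d , w⇝d , x~d) →
    let c↛d = λ c⇝d → y↛w (ReachIn-trans G (ReachIn-trans G y⇝c c⇝d) (ReachIn-sym G w⇝d))
        x~y = adjacent-to-component G cog (x∈p⇒x∉∁p x∈S) x~d (ReachIn-target∈ G w⇝d)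
                c↛d x~c (ReachIn-sym G y⇝c)
    in case trans (≡-sym x~y) x≁y of λ () } }
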